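{- For all $P,Q\in\mathsf{pCSP}$: if $[\![P]\!]\models\phi_{[\![Q]\!]}$ then $P\sqsubseteq_{FS}Q$; and if $[\![Q]\!]\models\psi_{[\![P]\!]}$ then $P\sqsubseteq_SQ$.
   Context: Processes. Let $\mathsf{Act}$ be a finite set of visible actions, $\tau\notin\mathsf{Act}$. Terms: $P::=S\mid P\oplus_pP$ ($0<p<1$), $S::=\mathbf 0\mid a.P\mid P\sqcap P\mid S\Box S\mid S|_AS$; $\mathsf{pCSP}$ = all terms, $\mathsf{sCSP}$ = sort $S$; $\Box,|_A$ on non-state-based terms distribute over $\oplus_p$. $\mathcal D(X)$: finitely supported probability distributions, support $\lceil\Delta\rceil$, point distribution $\overline x$. $[\![s]\!]=\overline s$, $[\![P\oplus_pQ]\!]=p[\![P]\!]+(1-p)[\![Q]\!]$. Transitions $s\xrightarrow{\alpha}\Delta$: $a.P\xrightarrow{a}[\![P]\!]$; $P\sqcap Q\xrightarrow{\tau}[\![P]\!],[\![Q]\!]$; visible moves of $s_1$ (resp. $s_2$) are moves of $s_1\Box s_2$; $s_1\xrightarrow{\tau}\Delta$ gives $s_1\Box s_2\xrightarrow{\tau}\Delta\Box s_2$ (symm.); $s_1\xrightarrow{\alpha}\Delta$, $\alpha\notin A$, gives $s_1|_As_2\xrightarrow{\alpha}\Delta|_As_2$ (symm.); $s_i\xrightarrow{a}\Delta_i$, $a\in A$, gives $s_1|_As_2\xrightarrow{\tau}\Delta_1|_A\Delta_2$. Weak moves and simulations: lifting $\Delta\overline{\mathcal R}\Theta$ iff $\Delta=\sum_ip_i\overline{s_i}$,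 $s_i\mathcal R\Phi_i$, $\Theta=\sum_ip_i\Phi_i$ (finite, weights sum 1, $s_i$ not necessarily distinct); transitions lifted likewise; $s\xrightarrow{\hat\tau}\Delta$ iff $s\xrightarrow{\tau}\Delta$ or $\Delta=\overline s$; $\stackrel{\hat\tau}{\Longrightarrow}$ = reflexive transitive closure of lifted $\xrightarrow{\hat\tau}$; $\stackrel{\hat a}{\Longrightarrow}=\stackrel{\hat\tau}{\Longrightarrow}\xrightarrow{a}\stackrel{\hat\tau}{\Longrightarrow}$. $s\not\xrightarrow{X}$ ($X\subseteq\mathsf{Act}$): no $\alpha$-move for $\alpha\in X\cup\{\tau\}$; for $\Delta$: for all support states. Simulation: $s\mathcal R\Theta$, $s\xrightarrow{\alpha}\Delta$ imply $\Theta\stackrel{\hat\alpha}{\Longrightarrow}\Theta'$ with $\Delta\overline{\mathcal R}\Theta'$ ($\hat\alpha=\hat\tau$ for $\alpha=\tau$); failure simulation: additionally $s\mathcal R\Theta$, $s\not\xrightarrow{X}$ imply $\Theta\stackrel{\hat\tau}{\Longrightarrow}\Theta'\not\xrightarrow{X}$. $\lhd_S,\lhd_{FS}$ the unions; $P\sqsubseteq_SQ$ iff $[\![Q]\!]\stackrel{\hat\tau}{\Longrightarrow}\Theta$ with $[\![P]\!]\overline{\lhd_S}\Theta$; $P\sqsubseteq_{FS}Q$ iff $[\![P]\!]\stackrel{\hat\tau}{\Longrightarrow}\Theta$ with $[\![Q]\!]\overline{\lhd_{FS}}\Theta$. Logic: formulas $\mathrm{ref}(X)$, $\langle a\rangle\phi$,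 $\bigwedge_{i\in I}\phi_i$, $\bigoplus_{i\in I}p_i\cdot\phi_i$ (finite $I$, $\sum p_i=1$), with satisfaction on distributions: $\Delta\models\mathrm{ref}(X)$ iff $\Delta\stackrel{\hat\tau}{\Longrightarrow}\Delta'\not\xrightarrow{X}$; $\Delta\models\langle a\rangle\phi$ iff $\Delta\stackrel{\hat a}{\Longrightarrow}\Delta'\models\phi$; conjunction as usual; $\Delta\models\bigoplus_ip_i\cdot\phi_i$ iff $\Delta\stackrel{\hat\tau}{\Longrightarrow}\sum_ip_i\Delta_i$ with $\Delta_i\models\phi_i$. Characteristic formulas (defined by induction on the finite transition structure): for $s\in\mathsf{sCSP}$ with no $\tau$-transition, $\phi_s=\bigwedge_{s\xrightarrow{a}\Delta}\langle a\rangle\phi_\Delta\wedge\mathrm{ref}(\{a\in\mathsf{Act}: s \text{ has no } a\text{ -transition}\})$; otherwise $\phi_s=\bigwedge_{s\xrightarrow{a}\Delta}\langle a\rangle\phi_\Delta\wedge\bigwedge_{s\xrightarrow{\tau}\Delta}\phi_\Delta$; and $\phi_\Delta=\bigoplus_{s\in\lceil\Delta\rceil}\Delta(s)\cdot\phi_s$. The formulas $\psi_s,\psi_\Delta$ are defined in the same way but omitting the conjunct $\mathrm{ref}(\cdot)$.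
   Formalization: The probabilities p of $P\oplus_pQ$, the lifting weights and the weights of ⨁ formulas, together with the component distributions witnessing their satisfaction, take rational values. -}

module Defs where

open import Level using (Level; _⊔_) renaming (suc to lsuc; zero to lzero)
open import Data.Nat using (ℕ)
open import Data.Bool using (Bool; true; false)
import Data.Bool.Properties as BoolP
open import Data.Fin using (Fin)
import Data.Fin.Properties as FinP
open import Data.Fin.Subset using (Subset; _∈_; _∉_)
import Data.Vec.Properties as VecP
open import Data.Rational using (ℚ; 0ℚ; 1ℚ; _<_; _+_; _*_; _-_)
import Data.Rational.Properties as ℚP
open import Data.Product using (Σ; _×_; _,_; proj₁; proj₂)
open import Data.Sum using (_⊎_; inj₁; inj₂; [_,_])
open import Data.Unit using (⊤; tt)
open import Data.Empty using (⊥)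
open import Data.List using (List; []; _∷_; _++_; map; foldr; filter; deduplicate; concatMap)
import Data.List.Membership.Propositional as LMem
open import Data.List.Relation.Unary.All using (All)
open import Relation.Nullary using (¬_; Dec; yes; no)
open import Relation.Binary.PropositionalEquality using (_≡_; refl; cong)
open import Relation.Binary.Construct.Closure.ReflexiveTransitive using (Star)

module CSP (n : ℕ) where

  Act : Set
  Act = Fin n

  data Lab : Set where
    τ   : Lab
    vis : Act → Lab

  -- Syntax.  Proc = pCSP (sort P), State = sCSP (sort S).
  -- Probabilities are rationals 0 < p < 1.

  mutual
    data Proc : Set where
      st  : State → Proc
      psum : Proc → (p : ℚ) → 0ℚ < p → p < 1ℚ → Proc → Proc

    data State : Set where
      nil  : State
      pre  : Act → Proc → State
      ich  : Proc → Proc → State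
      ech  : State → State → State
      par  : State → Subset n → State → State

  mutual
    _≟P_ : (P Q : Proc) → Dec (P ≡ Q)
    st s ≟P st t with s ≟S t
    ... | yes refl = yes refl
    ... | no ne = no λ { refl → ne refl }
    st _ ≟P psum _ _ _ _ _ = no λ ()
    psum _ _ _ _ _ ≟P st _ = no λ ()
    psum P p h1 h2 Q ≟P psum P' p' h1' h2' Q' with P ≟P P' | p ℚP.≟ p' | Q ≟P Q'
    ... | no ne | _ | _ = no λ { refl → ne refl }
    ... | yes _ | no ne | _ = no λ { refl → ne refl }
    ... | yes _ | yes _ | no ne = no λ { refl → ne refl }
    ... | yes refl | yes refl | yes refl
      with ℚP.<-irrelevant h1 h1' | ℚP.<-irrelevant h2 h2'
    ... | refl | refl = yes refl

    _≟S_ : (s t : State) → Dec (s ≡ t)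
    nil ≟S nil = yes refl
    nil ≟S pre _ _ = no λ ()
    nil ≟S ich _ _ = no λ ()
    nil ≟S ech _ _ = no λ ()
    nil ≟S par _ _ _ = no λ ()
    pre _ _ ≟S nil = no λ ()
    pre a P ≟S pre b Q with a FinP.≟ b | P ≟P Q
    ... | yes refl | yes refl = yes refl
    ... | no ne | _ = no λ { refl → ne refl }
    ... | yes _ | no ne = no λ { refl → ne refl }
    pre _ _ ≟S ich _ _ = no λ ()
    pre _ _ ≟S ech _ _ = no λ ()
    pre _ _ ≟S par _ _ _ = no λ ()
    ich _ _ ≟S nil = no λ ()
    ich _ _ ≟S pre _ _ = no λ ()
    ich P Q ≟S ich P' Q' with P ≟P P' | Q ≟P Q'
    ... | yes refl | yes refl = yes refl
    ... | no ne | _ = no λ { refl → ne refl }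
    ... | yes _ | no ne = no λ { refl → ne refl }
    ich _ _ ≟S ech _ _ = no λ ()
    ich _ _ ≟S par _ _ _ = no λ ()
    ech _ _ ≟S nil = no λ ()
    ech _ _ ≟S pre _ _ = no λ ()
    ech _ _ ≟S ich _ _ = no λ ()
    ech s t ≟S ech s' t' with s ≟S s' | t ≟S t'
    ... | yes refl | yes refl = yes refl
    ... | no ne | _ = no λ { refl → ne refl }
    ... | yes _ | no ne = no λ { refl → ne refl }
    ech _ _ ≟S par _ _ _ = no λ ()
    par _ _ _ ≟S nil = no λ ()
    par _ _ _ ≟S pre _ _ = no λ ()
    par _ _ _ ≟S ich _ _ = no λ ()
    par _ _ _ ≟S ech _ _ = no λ ()
    par s A t ≟S par s' A' t' with s ≟S s' | VecP.≡-dec BoolP._≟_ A A' | t ≟S t'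
    ... | yes refl | yes refl | yes refl = yes refl
    ... | no ne | _ | _ = no λ { refl → ne refl }
    ... | yes _ | no ne | _ = no λ { refl → ne refl }
    ... | yes _ | yes _ | no ne = no λ { refl → ne refl }

  -- Distributions over states, represented as finite formal sums
  -- Σ p_i · s_i (lists of weighted states).  Two such sums denote the same
  -- distribution iff they give the same mass to every state (_≈ᴰ_).

  Dist : Set
  Dist = List (ℚ × State)

  mass : Dist → State → ℚ
  mass [] t = 0ℚ
  mass ((p , s) ∷ Δ) t with s ≟S t
  ... | yes _ = p + mass Δ t
  ... | no _  = mass Δ t

  _≈ᴰ_ : Dist → Dist → Set
  Δ ≈ᴰ Θ = (t : State) → mass Δ t ≡ mass Θ t

  total : Dist → ℚ
  total Δ = foldr (λ ps r → proj₁ ps + r) 0ℚ Δ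

  IsDist : Dist → Set
  IsDist Δ = All (λ ps → 0ℚ < proj₁ ps) Δ × total Δ ≡ 1ℚ

  supp : Dist → List State
  supp Δ = deduplicate _≟S_ (filter (λ s → 0ℚ ℚP.<? mass Δ s) (map proj₂ Δ))

  _∈⌈_⌉ : State → Dist → Set
  s ∈⌈ Δ ⌉ = 0ℚ < mass Δ s

  point : State → Dist
  point s = (1ℚ , s) ∷ []

  scale : ℚ → Dist → Dist
  scale p Δ = map (λ qs → (p * proj₁ qs , proj₂ qs)) Δ

  mix : List (ℚ × Dist) → Dist
  mix L = concatMap (λ pΔ → scale (proj₁ pΔ) (proj₂ pΔ)) L

  ⟦_⟧ : Proc → Dist
  ⟦ st s ⟧ = point s
  ⟦ psum P p _ _ Q ⟧ = scale p ⟦ P ⟧ ++ scale (1ℚ - p) ⟦ Q ⟧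

  _□ᴰ_ : Dist → State → Dist
  Δ □ᴰ s = map (λ qt → (proj₁ qt , ech (proj₂ qt) s)) Δ

  _ᴰ□_ : State → Dist → Dist
  s ᴰ□ Δ = map (λ qt → (proj₁ qt , ech s (proj₂ qt))) Δ

  parD : Dist → Subset n → Dist → Dist
  parD Δ₁ A Δ₂ =
    concatMap (λ pt → map (λ qu → (proj₁ pt * proj₁ qu , par (proj₂ pt) A (proj₂ qu))) Δ₂) Δ₁

  parDˡ : Dist → Subset n → State → Dist
  parDˡ Δ A s = map (λ qt → (proj₁ qt , par (proj₂ qt) A s)) Δ

  parDʳ : State → Subset n → Dist → Dist
  parDʳ s A Δ = map (λ qt → (proj₁ qt , par s A (proj₂ qt))) Δ

  LabNotIn : Lab → Subset n → Set
  LabNotIn τ A = ⊤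
  LabNotIn (vis a) A = a ∉ A

  infix 4 _—[_]→_
  data _—[_]→_ : State → Lab → Dist → Set where
    t-pre  : ∀ {a P} → pre a P —[ vis a ]→ ⟦ P ⟧
    t-ichL : ∀ {P Q} → ich P Q —[ τ ]→ ⟦ P ⟧
    t-ichR : ∀ {P Q} → ich P Q —[ τ ]→ ⟦ Q ⟧
    t-echL : ∀ {s₁ s₂ a Δ} → s₁ —[ vis a ]→ Δ → ech s₁ s₂ —[ vis a ]→ Δ
    t-echR : ∀ {s₁ s₂ a Δ} → s₂ —[ vis a ]→ Δ → ech s₁ s₂ —[ vis a ]→ Δ
    t-echτL : ∀ {s₁ s₂ Δ} → s₁ —[ τ ]→ Δ → ech s₁ s₂ —[ τ ]→ Δ □ᴰ s₂
    t-echτR : ∀ {s₁ s₂ Δ} → s₂ —[ τ ]→ Δ → ech s₁ s₂ —[ τ ]→ s₁ ᴰ□ Δ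
    t-parL : ∀ {s₁ s₂ A α Δ} → LabNotIn α A → s₁ —[ α ]→ Δ → par s₁ A s₂ —[ α ]→ parDˡ Δ A s₂
    t-parR : ∀ {s₁ s₂ A α Δ} → LabNotIn α A → s₂ —[ α ]→ Δ → par s₁ A s₂ —[ α ]→ parDʳ s₁ A Δ
    t-sync : ∀ {s₁ s₂ A a Δ₁ Δ₂} → a ∈ A → s₁ —[ vis a ]→ Δ₁ → s₂ —[ vis a ]→ Δ₂ →
             par s₁ A s₂ —[ τ ]→ parD Δ₁ A Δ₂

  Lift : ∀ {ℓ} → (State → Dist → Set ℓ) → Dist → Dist → Set ℓ
  Lift R Δ Θ =
    Σ (List (ℚ × State × Dist)) λ L →
      All (λ x → 0ℚ < proj₁ x × R (proj₁ (proj₂ x)) (proj₂ (proj₂ x))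
                 × IsDist (proj₂ (proj₂ x))) L
      × total (map (λ x → (proj₁ x , proj₁ (proj₂ x))) L) ≡ 1ℚ
      × Δ ≈ᴰ map (λ x → (proj₁ x , proj₁ (proj₂ x))) L
      × Θ ≈ᴰ mix (map (λ x → (proj₁ x , proj₂ (proj₂ x))) L)

  τ̂-step : State → Dist → Set
  τ̂-step s Δ = (s —[ τ ]→ Δ) ⊎ (Δ ≡ point s)

  _⟹τ̂_ : Dist → Dist → Set
  _⟹τ̂_ = Star (Lift τ̂-step)

  Weak̂ : Lab → Dist → Dist → Set
  Weak̂ τ Δ Θ = Δ ⟹τ̂ Θ
  Weak̂ (vis a) Δ Θ =
    Σ Dist λ Δ₁ → Σ Dist λ Δ₂ →
      Δ ⟹τ̂ Δ₁ × Lift (λ s Φ → s —[ vis a ]→ Φ) Δ₁ Δ₂ × Δ₂ ⟹τ̂ Θ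

  RefS : (Act → Set) → State → Set
  RefS X s = ((a : Act) → X a → (Δ : Dist) → ¬ (s —[ vis a ]→ Δ))
             × ((Δ : Dist) → ¬ (s —[ τ ]→ Δ))

  RefD : (Act → Set) → Dist → Set
  RefD X Δ = (s : State) → s ∈⌈ Δ ⌉ → RefS X s

  IsSim : (State → Dist → Set) → Set
  IsSim R = ∀ s Θ → R s Θ → ∀ α Δ → s —[ α ]→ Δ →
            Σ Dist λ Θ' → Weak̂ α Θ Θ' × Lift R Δ Θ'

  IsFailSim : (State → Dist → Set) → Set₁
  IsFailSim R = IsSim R ×
    (∀ s Θ → R s Θ → (X : Act → Set) → RefS X s →
       Σ Dist λ Θ' → Θ ⟹τ̂ Θ' × RefD X Θ')

  _◁S_ : State → Dist → Set₁
  s ◁S Θ = Σ (State → Dist → Set) λ R → IsSim R × R s Θ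

  _◁FS_ : State → Dist → Set₁
  s ◁FS Θ = Σ (State → Dist → Set) λ R → IsFailSim R × R s Θ

  _⊑S_ : Proc → Proc → Set₁
  P ⊑S Q = Σ Dist λ Θ → ⟦ Q ⟧ ⟹τ̂ Θ × Lift _◁S_ ⟦ P ⟧ Θ

  _⊑FS_ : Proc → Proc → Set₁
  P ⊑FS Q = Σ Dist λ Θ → ⟦ P ⟧ ⟹τ̂ Θ × Lift _◁FS_ ⟦ Q ⟧ Θ

  data Form : Set₁ where
    ref : (Act → Set) → Form
    ⟨_⟩_ : Act → Form → Form
    ⋀ : {I : Set} → (I → Form) → Form
    ⨁ : List (ℚ × Form) → Form

  mutual
    _⊨_ : Dist → Form → Set
    Δ ⊨ ref X = Σ Dist λ Δ' → Δ ⟹τ̂ Δ' × RefD X Δ'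
    Δ ⊨ (⟨ a ⟩ φ) = Σ Dist λ Δ' → Weak̂ (vis a) Δ Δ' × Δ' ⊨ φ
    Δ ⊨ ⋀ {I} f = (i : I) → Δ ⊨ f i
    Δ ⊨ ⨁ L = Σ (List Dist) λ Ds → SatList Ds L × Δ ⟹τ̂ mixF L Ds

    SatList : List Dist → List (ℚ × Form) → Set
    SatList [] [] = ⊤
    SatList (D ∷ Ds) ((p , φ) ∷ L) = (IsDist D × D ⊨ φ) × SatList Ds L
    SatList [] (_ ∷ _) = ⊥
    SatList (_ ∷ _) [] = ⊥

    mixF : List (ℚ × Form) → List Dist → Dist
    mixF ((p , _) ∷ L) (D ∷ Ds) = scale p D ++ mixF L Ds
    mixF _ _ = []

  -- Characteristic formulas, as the graph of their inductive definition.
  -- b = true : φ_s, φ_Δ  (with the ref conjunct);  b = false : ψ_s, ψ_Δ.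

  VisT : State → Set
  VisT s = Σ Act λ a → Σ Dist λ Δ → s —[ vis a ]→ Δ

  TauT : State → Set
  TauT s = Σ Dist λ Δ → s —[ τ ]→ Δ

  visAct : ∀ {s} → VisT s → Act
  visAct t = proj₁ t

  visTgt : ∀ {s} → VisT s → Dist
  visTgt t = proj₁ (proj₂ t)

  tauTgt : ∀ {s} → TauT s → Dist
  tauTgt t = proj₁ t

  RefIdx : Bool → Set
  RefIdx true = ⊤
  RefIdx false = ⊥

  initRef : State → Act → Set
  initRef s a = ¬ (Σ Dist λ Δ → s —[ vis a ]→ Δ)

  mutual
    data CharS (b : Bool) : State → Form → Set₁ where
      char-stable : ∀ {s} (f : VisT s → Form) →
        ((t : VisT s) → CharD b (visTgt t) (f t)) →
        ((Δ : Dist) → ¬ (s —[ τ ]→ Δ)) →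
        CharS b s (⋀ {VisT s ⊎ RefIdx b}
                     [ (λ t → ⟨ visAct t ⟩ f t) , (λ _ → ref (initRef s)) ])
      char-unstable : ∀ {s} (f : VisT s → Form) (g : TauT s → Form) →
        ((t : VisT s) → CharD b (visTgt t) (f t)) →
        ((t : TauT s) → CharD b (tauTgt t) (g t)) →
        TauT s →
        CharS b s (⋀ {VisT s ⊎ TauT s} [ (λ t → ⟨ visAct t ⟩ f t) , g ])

    data CharD (b : Bool) : Dist → Form → Set₁ where
      char-dist : ∀ {Δ} (h : State → Form) →
        ((s : State) → s LMem.∈ supp Δ → CharS b s (h s)) →
        CharD b Δ (⨁ (map (λ s → (mass Δ s , h s)) (supp Δ)))

-- The idea is to read satisfaction of a characteristic formula as a
-- simulation.  We define an inductive relation  CharSim b s Θ  ("Θ meets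
-- every requirement of the characteristic formula of s"): every move of s
-- is weakly matched by Θ with lifted CharSim-related targets, and, when
-- b = true and s is stable, Θ can reach a distribution refusing all
-- actions that s cannot perform.  By construction CharSim false is a
-- simulation and CharSim true a failure simulation.

module Submission where

open import Defs
open import Data.Nat using (ℕ)
open import Data.Bool using (Bool; true; false)
open import Data.Product using (Σ; _×_; _,_; proj₁; proj₂)
open import Data.Sum using (inj₁; inj₂; [_,_])
open import Data.Unit using (tt)
open import Data.Empty using (⊥-elim)
open import Data.List using (List; []; _∷_; _++_; map; foldr; filter)
open import Data.List.Relation.Unary.All as All using (All; []; _∷_)
open import Data.List.Relation.Unary.All.Properties using (All¬⇒¬Any)
open import Data.List.Relation.Unary.Any using (here; there)
open import Data.List.Relation.Unary.Unique.Propositional using (Unique)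
open import Data.List.Relation.Unary.AllPairs using ([]; _∷_)
open import Data.List.Membership.Propositional using (_∈_; _∉_)
open import Data.List.Membership.Propositional.Properties
  using (∈-filter⁻; ∈-filter⁺; ∈-deduplicate⁻; ∈-deduplicate⁺)
open import Data.List.Relation.Unary.Unique.DecPropositional.Properties using (deduplicate-!)
import Data.List.Membership.DecPropositional as DecMembership
open import Data.Rational using (ℚ; 0ℚ; 1ℚ; _<_; _≤_; _+_; _*_; _-_; -_; positive)
import Data.Rational.Properties as ℚP
open import Data.Rational.Solver using (module +-*-Solver)
open import Relation.Nullary using (¬_; yes; no)
open import Relation.Binary.PropositionalEquality
  using (_≡_; refl; cong; cong₂; sym; trans; subst; module ≡-Reasoning)
open import Relation.Binary.Construct.Closure.ReflexiveTransitive using (ε; _◅◅_)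

module Development (n : ℕ) where
  open CSP n

  -- 1. Terms and transitions denote probability distributions.

  PositiveWeights : Dist → Set
  PositiveWeights = All (λ ps → 0ℚ < proj₁ ps)

  -- Rescaling every weight by p and renaming every state by g; this covers
  -- both  scale p Δ  and the rows of the product distribution  parD.
  weighted : ℚ → (State → State) → Dist → Dist
  weighted p g Δ = map (λ qt → (p * proj₁ qt , g (proj₂ qt))) Δ

  relabel : (State → State) → Dist → Dist
  relabel g Δ = map (λ qt → (proj₁ qt , g (proj₂ qt))) Δ

  0<p*q : ∀ {p q} → 0ℚ < p → 0ℚ < q → 0ℚ < p * q
  0<p*q {p} {q} 0<p 0<q =
    ℚP.positive⁻¹ (p * q) {{ℚP.pos*pos⇒pos p {{positive 0<p}} q {{positive 0<q}}}}

  0<1-p : ∀ {p} → p < 1ℚ → 0ℚ < 1ℚ - p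
  0<1-p {p} p<1 = subst (_< 1ℚ - p) (ℚP.+-inverseʳ p) (ℚP.+-monoˡ-< (- p) p<1)

  total-++ : ∀ Δ Θ → total (Δ ++ Θ) ≡ total Δ + total Θ
  total-++ [] Θ = sym (ℚP.+-identityˡ (total Θ))
  total-++ ((p , _) ∷ Δ) Θ =
    trans (cong (p +_) (total-++ Δ Θ)) (sym (ℚP.+-assoc p (total Δ) (total Θ)))

  total-weighted : ∀ p g Δ → total (weighted p g Δ) ≡ p * total Δ
  total-weighted p g [] = sym (ℚP.*-zeroʳ p)
  total-weighted p g ((q , _) ∷ Δ) =
    trans (cong (p * q +_) (total-weighted p g Δ)) (sym (ℚP.*-distribˡ-+ p q (total Δ)))

  total-relabel : ∀ g Δ → total (relabel g Δ) ≡ total Δ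
  total-relabel g [] = refl
  total-relabel g ((q , _) ∷ Δ) = cong (q +_) (total-relabel g Δ)

  total-parD : ∀ Δ₁ A Δ₂ → total (parD Δ₁ A Δ₂) ≡ total Δ₁ * total Δ₂
  total-parD [] A Δ₂ = sym (ℚP.*-zeroˡ (total Δ₂))
  total-parD ((p , t) ∷ Δ₁) A Δ₂ = begin
    total (weighted p (λ u → par t A u) Δ₂ ++ parD Δ₁ A Δ₂)
      ≡⟨ total-++ (weighted p (λ u → par t A u) Δ₂) (parD Δ₁ A Δ₂) ⟩
    total (weighted p (λ u → par t A u) Δ₂) + total (parD Δ₁ A Δ₂)
      ≡⟨ cong₂ _+_ (total-weighted p (λ u → par t A u) Δ₂) (total-parD Δ₁ A Δ₂) ⟩
    p * total Δ₂ + total Δ₁ * total Δ₂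
      ≡⟨ sym (ℚP.*-distribʳ-+ (total Δ₂) p (total Δ₁)) ⟩
    (p + total Δ₁) * total Δ₂ ∎
    where open ≡-Reasoning

  positive-++ : ∀ {Δ Θ} → PositiveWeights Δ → PositiveWeights Θ → PositiveWeights (Δ ++ Θ)
  positive-++ [] pΘ = pΘ
  positive-++ (w ∷ pΔ) pΘ = w ∷ positive-++ pΔ pΘ

  positive-weighted : ∀ {p} g {Δ} → 0ℚ < p → PositiveWeights Δ →
                      PositiveWeights (weighted p g Δ)
  positive-weighted g 0<p [] = []
  positive-weighted g 0<p (w ∷ pΔ) = 0<p*q 0<p w ∷ positive-weighted g 0<p pΔ

  positive-relabel : ∀ g {Δ} → PositiveWeights Δ → PositiveWeights (relabel g Δ)
  positive-relabel g [] = []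
  positive-relabel g (w ∷ pΔ) = w ∷ positive-relabel g pΔ

  positive-parD : ∀ {Δ₁} A {Δ₂} → PositiveWeights Δ₁ → PositiveWeights Δ₂ →
                  PositiveWeights (parD Δ₁ A Δ₂)
  positive-parD A [] pΔ₂ = []
  positive-parD A (w ∷ pΔ₁) pΔ₂ =
    positive-++ (positive-weighted _ w pΔ₂) (positive-parD A pΔ₁ pΔ₂)

  isDist-relabel : ∀ g {Δ} → IsDist Δ → IsDist (relabel g Δ)
  isDist-relabel g {Δ} (pΔ , tΔ) = positive-relabel g pΔ , trans (total-relabel g Δ) tΔ

  isDist-⊕ : ∀ {p Δ Θ} → 0ℚ < p → p < 1ℚ → IsDist Δ → IsDist Θ →
             IsDist (scale p Δ ++ scale (1ℚ - p) Θ)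
  isDist-⊕ {p} {Δ} {Θ} 0<p p<1 (pΔ , tΔ) (pΘ , tΘ) =
    positive-++ (positive-weighted _ 0<p pΔ) (positive-weighted _ (0<1-p p<1) pΘ) ,
    (begin
      total (scale p Δ ++ scale (1ℚ - p) Θ)
        ≡⟨ total-++ (scale p Δ) (scale (1ℚ - p) Θ) ⟩
      total (scale p Δ) + total (scale (1ℚ - p) Θ)
        ≡⟨ cong₂ _+_ (total-weighted p (λ t → t) Δ) (total-weighted (1ℚ - p) (λ t → t) Θ) ⟩
      p * total Δ + (1ℚ - p) * total Θ
        ≡⟨ cong₂ (λ x y → p * x + (1ℚ - p) * y) tΔ tΘ ⟩
      p * 1ℚ + (1ℚ - p) * 1ℚ
        ≡⟨ convex-one p ⟩
      1ℚ ∎)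
    where
    open ≡-Reasoning
    open +-*-Solver
    convex-one : ∀ p → p * 1ℚ + (1ℚ - p) * 1ℚ ≡ 1ℚ
    convex-one = solve 1 (λ x → x :* con 1ℚ :+ (con 1ℚ :- x) :* con 1ℚ := con 1ℚ) refl

  isDist-parD : ∀ {Δ₁} A {Δ₂} → IsDist Δ₁ → IsDist Δ₂ → IsDist (parD Δ₁ A Δ₂)
  isDist-parD {Δ₁} A {Δ₂} (p₁ , t₁) (p₂ , t₂) =
    positive-parD A p₁ p₂ ,
    trans (total-parD Δ₁ A Δ₂) (trans (cong₂ _*_ t₁ t₂) (ℚP.*-identityʳ 1ℚ))

  isDist-⟦⟧ : ∀ P → IsDist ⟦ P ⟧
  isDist-⟦⟧ (st s) = (ℚP.positive⁻¹ 1ℚ ∷ []) , ℚP.+-identityʳ 1ℚ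
  isDist-⟦⟧ (psum P p 0<p p<1 Q) = isDist-⊕ 0<p p<1 (isDist-⟦⟧ P) (isDist-⟦⟧ Q)

  isDist-target : ∀ {s α Δ} → s —[ α ]→ Δ → IsDist Δ
  isDist-target (t-pre {P = P}) = isDist-⟦⟧ P
  isDist-target (t-ichL {P = P}) = isDist-⟦⟧ P
  isDist-target (t-ichR {Q = Q}) = isDist-⟦⟧ Q
  isDist-target (t-echL tr) = isDist-target tr
  isDist-target (t-echR tr) = isDist-target tr
  isDist-target (t-echτL {s₂ = s₂} tr) = isDist-relabel (λ t → ech t s₂) (isDist-target tr)
  isDist-target (t-echτR {s₁ = s₁} tr) = isDist-relabel (λ t → ech s₁ t) (isDist-target tr)
  isDist-target (t-parL {s₂ = s₂} {A = A} _ tr) =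
    isDist-relabel (λ t → par t A s₂) (isDist-target tr)
  isDist-target (t-parR {s₁ = s₁} {A = A} _ tr) =
    isDist-relabel (λ t → par s₁ A t) (isDist-target tr)
  isDist-target (t-sync {A = A} _ tr₁ tr₂) =
    isDist-parD A (isDist-target tr₁) (isDist-target tr₂)

  -- 2. A distribution is the weighted sum of its support.

  sumOver : List State → (State → ℚ) → ℚ
  sumOver U f = foldr (λ u r → f u + r) 0ℚ U

  tabulateOn : (State → ℚ) → List State → Dist
  tabulateOn f U = map (λ u → (f u , u)) U

  -- Σ_{s ∈ ⌈Δ⌉} Δ(s)·s̄ : the decomposition that φ_Δ is built on.
  canonical : Dist → Dist
  canonical Δ = tabulateOn (mass Δ) (supp Δ)

  mass-∉ : ∀ Δ {t} → t ∉ map proj₂ Δ → mass Δ t ≡ 0ℚ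
  mass-∉ [] t∉ = refl
  mass-∉ ((_ , s) ∷ Δ) {t} t∉ with s ≟S t
  ... | yes refl = ⊥-elim (t∉ (here refl))
  ... | no _ = mass-∉ Δ (λ t∈ → t∉ (there t∈))

  mass-nonneg : ∀ {Δ} t → PositiveWeights Δ → 0ℚ ≤ mass Δ t
  mass-nonneg t [] = ℚP.≤-refl
  mass-nonneg {(p , s) ∷ Δ} t (w ∷ pΔ) with s ≟S t
  ... | yes _ = subst (_≤ p + mass Δ t) (ℚP.+-identityˡ 0ℚ)
                  (ℚP.+-mono-≤ (ℚP.<⇒≤ w) (mass-nonneg t pΔ))
  ... | no _ = mass-nonneg t pΔ

  mass-pos : ∀ {Δ t} → PositiveWeights Δ → t ∈ map proj₂ Δ → 0ℚ < mass Δ t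
  mass-pos {(p , s) ∷ Δ} {t} (w ∷ pΔ) t∈ with s ≟S t
  ... | yes _ = subst (_< p + mass Δ t) (ℚP.+-identityˡ 0ℚ)
                  (ℚP.+-mono-<-≤ w (mass-nonneg t pΔ))
  mass-pos (w ∷ pΔ) (here t≡s) | no s≢t = ⊥-elim (s≢t (sym t≡s))
  mass-pos (w ∷ pΔ) (there t∈) | no _ = mass-pos pΔ t∈

  sumOver-cons-∉ : ∀ p s Δ U → s ∉ U → sumOver U (mass ((p , s) ∷ Δ)) ≡ sumOver U (mass Δ)
  sumOver-cons-∉ p s Δ [] s∉ = refl
  sumOver-cons-∉ p s Δ (u ∷ U) s∉ with s ≟S u
  ... | yes refl = ⊥-elim (s∉ (here refl))
  ... | no _ = cong (mass Δ u +_) (sumOver-cons-∉ p s Δ U (λ s∈ → s∉ (there s∈)))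

  sumOver-cons-∈ : ∀ p s Δ U → Unique U → s ∈ U →
                   sumOver U (mass ((p , s) ∷ Δ)) ≡ p + sumOver U (mass Δ)
  sumOver-cons-∈ p s Δ (u ∷ U) (s∉U ∷ uU) s∈ with s ≟S u
  ... | yes refl =
    trans (cong (p + mass Δ s +_) (sumOver-cons-∉ p s Δ U (All¬⇒¬Any s∉U)))
          (ℚP.+-assoc p (mass Δ s) (sumOver U (mass Δ)))
  sumOver-cons-∈ p s Δ (u ∷ U) (_ ∷ uU) (here s≡u) | no s≢u = ⊥-elim (s≢u s≡u)
  sumOver-cons-∈ p s Δ (u ∷ U) (_ ∷ uU) (there s∈) | no _ = begin
    mass Δ u + sumOver U (mass ((p , s) ∷ Δ)) ≡⟨ cong (mass Δ u +_) (sumOver-cons-∈ p s Δ U uU s∈) ⟩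
    mass Δ u + (p + sumOver U (mass Δ))       ≡⟨ sym (ℚP.+-assoc (mass Δ u) p _) ⟩
    mass Δ u + p + sumOver U (mass Δ)         ≡⟨ cong (_+ sumOver U (mass Δ)) (ℚP.+-comm (mass Δ u) p) ⟩
    p + mass Δ u + sumOver U (mass Δ)         ≡⟨ ℚP.+-assoc p (mass Δ u) _ ⟩
    p + (mass Δ u + sumOver U (mass Δ))       ∎
    where open ≡-Reasoning

  sumOver-mass-[] : ∀ U → sumOver U (mass []) ≡ 0ℚ
  sumOver-mass-[] [] = refl
  sumOver-mass-[] (u ∷ U) = trans (ℚP.+-identityˡ _) (sumOver-mass-[] U)

  total≡sumOver-mass : ∀ Δ U → Unique U → (∀ s → s ∈ map proj₂ Δ → s ∈ U) →
                       total Δ ≡ sumOver U (mass Δ)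
  total≡sumOver-mass [] U uU cover = sym (sumOver-mass-[] U)
  total≡sumOver-mass ((p , s) ∷ Δ) U uU cover =
    trans (cong (p +_) (total≡sumOver-mass Δ U uU (λ t t∈ → cover t (there t∈))))
          (sym (sumOver-cons-∈ p s Δ U uU (cover s (here refl))))

  total-tabulateOn : ∀ f U → total (tabulateOn f U) ≡ sumOver U f
  total-tabulateOn f [] = refl
  total-tabulateOn f (u ∷ U) = cong (f u +_) (total-tabulateOn f U)

  mass-tabulateOn-∉ : ∀ f U {t} → t ∉ U → mass (tabulateOn f U) t ≡ 0ℚ
  mass-tabulateOn-∉ f [] t∉ = refl
  mass-tabulateOn-∉ f (u ∷ U) {t} t∉ with u ≟S t
  ... | yes refl = ⊥-elim (t∉ (here refl))
  ... | no _ = mass-tabulateOn-∉ f U (λ t∈ → t∉ (there t∈))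

  mass-tabulateOn-∈ : ∀ f U {t} → Unique U → t ∈ U → mass (tabulateOn f U) t ≡ f t
  mass-tabulateOn-∈ f (u ∷ U) {t} (u∉U ∷ uU) t∈ with u ≟S t
  ... | yes refl = trans (cong (f u +_) (mass-tabulateOn-∉ f U (All¬⇒¬Any u∉U)))
                         (ℚP.+-identityʳ (f u))
  mass-tabulateOn-∈ f (u ∷ U) (_ ∷ uU) (here t≡u) | no u≢t = ⊥-elim (u≢t (sym t≡u))
  mass-tabulateOn-∈ f (u ∷ U) (_ ∷ uU) (there t∈) | no _ = mass-tabulateOn-∈ f U uU t∈

  module Support (Δ : Dist) where

    private
      positive? = λ s → 0ℚ ℚP.<? mass Δ s

    supp-pos : ∀ {t} → t ∈ supp Δ → 0ℚ < mass Δ t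
    supp-pos t∈ = proj₂ (∈-filter⁻ positive? {xs = map proj₂ Δ}
                           (∈-deduplicate⁻ _≟S_ (filter positive? (map proj₂ Δ)) t∈))

    supp-covers : ∀ {t} → PositiveWeights Δ → t ∈ map proj₂ Δ → t ∈ supp Δ
    supp-covers pΔ t∈ = ∈-deduplicate⁺ _≟S_ (∈-filter⁺ positive? t∈ (mass-pos pΔ t∈))

    supp-unique : Unique (supp Δ)
    supp-unique = deduplicate-! _≟S_ (filter positive? (map proj₂ Δ))

    total-canonical : IsDist Δ → total (canonical Δ) ≡ 1ℚ
    total-canonical (pΔ , tΔ) =
      trans (total-tabulateOn (mass Δ) (supp Δ))
            (trans (sym (total≡sumOver-mass Δ (supp Δ) supp-unique (λ s → supp-covers pΔ))) tΔ)

    canonical-≈ : IsDist Δ → Δ ≈ᴰ canonical Δ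
    canonical-≈ (pΔ , _) t with DecMembership._∈?_ _≟S_ t (supp Δ)
    ... | yes t∈ = sym (mass-tabulateOn-∈ (mass Δ) (supp Δ) supp-unique t∈)
    ... | no t∉ = trans (mass-∉ Δ (λ t∈ → t∉ (supp-covers pΔ t∈)))
                        (sym (mass-tabulateOn-∉ (mass Δ) (supp Δ) t∉))

  open Support

  -- 3. Satisfaction of characteristic formulas yields (failure) simulations.

  data CharSim (b : Bool) : State → Dist → Set where
    charSim : ∀ {s Θ} →
      (∀ α Δ → s —[ α ]→ Δ → Σ Dist λ Θ' → Weak̂ α Θ Θ' × Lift (CharSim b) Δ Θ') →
      (RefIdx b → ((Δ : Dist) → ¬ (s —[ τ ]→ Δ)) →
         Σ Dist λ Θ' → Θ ⟹τ̂ Θ' × RefD (initRef s) Θ') →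
      CharSim b s Θ

  charSim-isSim : ∀ b → IsSim (CharSim b)
  charSim-isSim b s Θ (charSim sim _) = sim

  -- A stable state refusing X cannot perform any action of X, so the
  -- refusal of initRef s by the matching distribution covers X.
  charSim-isFailSim : IsFailSim (CharSim true)
  charSim-isFailSim = charSim-isSim true , refusal
    where
    refusal : ∀ s Θ → CharSim true s Θ → (X : Act → Set) → RefS X s →
              Σ Dist λ Θ' → Θ ⟹τ̂ Θ' × RefD X Θ'
    refusal s Θ (charSim _ refuse) X (s↛X , s-stable) with refuse tt s-stable
    ... | Θ' , Θ⟹Θ' , Θ'↛ = Θ' , Θ⟹Θ' , λ u u∈ →
          (λ a a∈X Δ tr → proj₁ (Θ'↛ u u∈) a (λ (Δ₀ , tr₀) → s↛X a a∈X Δ₀ tr₀) Δ tr) ,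
          proj₂ (Θ'↛ u u∈)

  weak-◅◅ : ∀ α {Θ Θ₁ Θ₂} → Weak̂ α Θ Θ₁ → Θ₁ ⟹τ̂ Θ₂ → Weak̂ α Θ Θ₂
  weak-◅◅ τ Θ⟹Θ₁ Θ₁⟹Θ₂ = Θ⟹Θ₁ ◅◅ Θ₁⟹Θ₂
  weak-◅◅ (vis a) (Δ₁ , Δ₂ , before , move , after) Θ₁⟹Θ₂ =
    Δ₁ , Δ₂ , before , move , after ◅◅ Θ₁⟹Θ₂

  lift-map : ∀ {ℓ ℓ'} {R : State → Dist → Set ℓ} {R' : State → Dist → Set ℓ'} {Δ Θ : Dist} →
             (∀ {s Φ} → R s Φ → R' s Φ) → Lift R Δ Θ → Lift R' Δ Θ
  lift-map f (L , all , t , eqΔ , eqΘ) =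
    L , All.map (λ (w , r , d) → w , f r , d) all , t , eqΔ , eqΘ

  -- Pairing the satisfying distributions Ds of ⨁_{u ∈ U} f u · h u with the
  -- states of U gives the list of triples witnessing a lifting.
  module Witness (f : State → ℚ) (h : State → Form) where

    formulas : List State → List (ℚ × Form)
    formulas U = map (λ u → (f u , h u)) U

    triples : ∀ U Ds → SatList Ds (formulas U) → List (ℚ × State × Dist)
    triples [] [] _ = []
    triples (u ∷ U) (D ∷ Ds) (_ , sat) = (f u , u , D) ∷ triples U Ds sat

    left-triples : ∀ U Ds sat →
      map (λ x → (proj₁ x , proj₁ (proj₂ x))) (triples U Ds sat) ≡ tabulateOn f U
    left-triples [] [] _ = refl
    left-triples (u ∷ U) (D ∷ Ds) (_ , sat) = cong ((f u , u) ∷_) (left-triples U Ds sat)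

    right-triples : ∀ U Ds sat →
      mixF (formulas U) Ds ≡ mix (map (λ x → (proj₁ x , proj₂ (proj₂ x))) (triples U Ds sat))
    right-triples [] [] _ = refl
    right-triples (u ∷ U) (D ∷ Ds) (_ , sat) = cong (scale (f u) D ++_) (right-triples U Ds sat)

    triples-ok : ∀ {ℓ} (R : State → Dist → Set ℓ) U Ds (sat : SatList Ds (formulas U)) →
      (∀ u → u ∈ U → 0ℚ < f u) →
      (∀ u → u ∈ U → (D : Dist) → D ⊨ h u → R u D) →
      All (λ x → 0ℚ < proj₁ x × R (proj₁ (proj₂ x)) (proj₂ (proj₂ x))
                 × IsDist (proj₂ (proj₂ x))) (triples U Ds sat)
    triples-ok R [] [] _ pos rel = []
    triples-ok R (u ∷ U) (D ∷ Ds) ((isDist , D⊨) , sat) pos rel =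
      (pos u (here refl) , rel u (here refl) D D⊨ , isDist) ∷
      triples-ok R U Ds sat (λ v v∈ → pos v (there v∈)) (λ v v∈ → rel v (there v∈))

  mutual
    -- Θ ⊨ φ_Δ: Θ reaches Σ_s Δ(s)·Θ_s with Θ_s ⊨ φ_s, hence Δ CharSim̄ Θ'.
    sat-charD : ∀ {b Δ φ Θ} → IsDist Δ → CharD b Δ φ → Θ ⊨ φ →
                Σ Dist λ Θ' → Θ ⟹τ̂ Θ' × Lift (CharSim b) Δ Θ'
    sat-charD {b} {Δ} isDist (char-dist h hChar) (Ds , sat , Θ⟹) =
      _ , Θ⟹ ,
      (triples (supp Δ) Ds sat ,
       triples-ok (CharSim b) (supp Δ) Ds sat (λ u → supp-pos Δ)
                  (λ u u∈ D D⊨ → sat-charS (hChar u u∈) D⊨) ,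
       trans (cong total (left-triples (supp Δ) Ds sat)) (total-canonical Δ isDist) ,
       (λ t → trans (canonical-≈ Δ isDist t)
                    (cong (λ Γ → mass Γ t) (sym (left-triples (supp Δ) Ds sat)))) ,
       (λ t → cong (λ Γ → mass Γ t) (right-triples (supp Δ) Ds sat)))
      where open Witness (mass Δ) h

    sat-charS : ∀ {b s φ Θ} → CharS b s φ → Θ ⊨ φ → CharSim b s Θ
    sat-charS (char-stable f fChar s-stable) sat =
      charSim (λ { τ Δ tr → ⊥-elim (s-stable Δ tr)
                 ; (vis a) Δ tr → match-visible fChar sat a Δ tr })
              (λ ref _ → sat (inj₂ ref))
    sat-charS (char-unstable f g fChar gChar (Δτ , trτ)) sat =
      charSim (λ { τ Δ tr → match ε (isDist-target tr) (gChar (Δ , tr)) (sat (inj₂ (Δ , tr)))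
                 ; (vis a) Δ tr → match-visible fChar sat a Δ tr })
              (λ _ s-stable → ⊥-elim (s-stable Δτ trτ))

    match : ∀ {b α Θ Θ₁ Δ φ} → Weak̂ α Θ Θ₁ → IsDist Δ → CharD b Δ φ → Θ₁ ⊨ φ →
            Σ Dist λ Θ' → Weak̂ α Θ Θ' × Lift (CharSim b) Δ Θ'
    match {α = α} Θ⟹Θ₁ isDist char Θ₁⊨ with sat-charD isDist char Θ₁⊨
    ... | Θ' , Θ₁⟹Θ' , lifted = Θ' , weak-◅◅ α Θ⟹Θ₁ Θ₁⟹Θ' , lifted

    match-visible : ∀ {b s Θ} {f : VisT s → Form} {J : Set} {k : J → Form} →
      ((t : VisT s) → CharD b (visTgt t) (f t)) →
      Θ ⊨ ⋀ [ (λ t → ⟨ visAct t ⟩ f t) , k ] →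
      ∀ a Δ → s —[ vis a ]→ Δ →
      Σ Dist λ Θ' → Weak̂ (vis a) Θ Θ' × Lift (CharSim b) Δ Θ'
    match-visible fChar sat a Δ tr with sat (inj₁ (a , Δ , tr))
    ... | Θ₁ , Θ⟹Θ₁ , Θ₁⊨ = match Θ⟹Θ₁ (isDist-target tr) (fChar (a , Δ , tr)) Θ₁⊨

lemma7p3 : (n : ℕ) → let open CSP n in
    (P Q : Proc) →
      ((φ : Form) → CharD true ⟦ Q ⟧ φ → ⟦ P ⟧ ⊨ φ → P ⊑FS Q)
      × ((ψ : Form) → CharD false ⟦ P ⟧ ψ → ⟦ Q ⟧ ⊨ ψ → P ⊑S Q)
lemma7p3 n P Q = failure-simulation , simulation
  where
  open CSP n
  open Development n

  failure-simulation : (φ : Form) → CharD true ⟦ Q ⟧ φ → ⟦ P ⟧ ⊨ φ → P ⊑FS Q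
  failure-simulation φ char sat with sat-charD (isDist-⟦⟧ Q) char sat
  ... | Θ , P⟹Θ , lifted = Θ , P⟹Θ , lift-map {Δ = ⟦ Q ⟧} {Θ} (λ r → CharSim true , charSim-isFailSim , r) lifted

  simulation : (ψ : Form) → CharD false ⟦ P ⟧ ψ → ⟦ Q ⟧ ⊨ ψ → P ⊑S Q
  simulation ψ char sat with sat-charD (isDist-⟦⟧ P) char sat
  ... | Θ , Q⟹Θ , lifted = Θ , Q⟹Θ , lift-map {Δ = ⟦ P ⟧} {Θ} (λ r → CharSim false , charSim-isSim false , r) lifted
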